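{- Let $n\ge2$ be a natural number and let $\mathbb F_2$ be the free group on generators $\sigma,\tau$. For a reduced word $\alpha$ let $I(\alpha)$ be the set of reduced words beginning with $\alpha$. Define $A_0^\ast:=I(\sigma)$, $B_0^\ast:=I(\sigma^{ -n+1})$, $\gamma_0:=\sigma^{n-1}$; $A_1^\ast:=I(\tau)$, $B_1^\ast:=I(\sigma^{ -n+2}\tau^{ -1})$, $\gamma_1:=\tau\sigma^{n-2}$; and for $2\le i<n$, $A_i^\ast:=I(\sigma^{ -i+1}\tau)$, $B_i^\ast:=I(\sigma^{ -i+2}\tau^{ -1})$, $\gamma_i:=\sigma^{ -i+1}\tau\sigma^{i-2}$. Let $i<n$, $k\ge1$ and $0\le m<n-1$. Then $\gamma_i^k\sigma^{ -m}\in A_i^\ast$ and $\gamma_i^{ -k}\sigma^{ -m}\in B_i^\ast$.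
   Context: Elements of $\mathbb F_2$ are identified with reduced words in $\sigma^{\pm1},\tau^{\pm1}$; $\sigma^0$ is the empty word. -}

module Defs where

open import Data.Bool using (Bool; true; false; not)
open import Data.List using (List; []; _∷_; _++_; foldr; reverse; map; replicate)
open import Data.Nat using (ℕ; zero; suc)
open import Data.Integer using (ℤ; +_; -[1+_]; -_; _+_)
open import Data.Product using (_×_; _,_; ∃)
open import Relation.Binary.PropositionalEquality using (_≡_)

data Gen : Set where
  σ τ : Gen

-- A letter: a generator together with an exponent sign (true = +1, false = -1).
Letter : Set
Letter = Gen × Bool

letterInv : Letter → Letter
letterInv (g , b) = (g , not b)

cancels : Letter → Letter → Bool
cancels (σ , true) (σ , false) = true
cancels (σ , false) (σ , true) = true
cancels (τ , true) (τ , false) = true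
cancels (τ , false) (τ , true) = true
cancels _ _ = false

Word : Set
Word = List Letter

data Reduced : Word → Set where
  nil  : Reduced []
  one  : ∀ x → Reduced (x ∷ [])
  cons : ∀ x y w → cancels x y ≡ false → Reduced (y ∷ w) → Reduced (x ∷ y ∷ w)

_•_ : Letter → Word → Word
x • [] = x ∷ []
x • (y ∷ w) with cancels x y
... | true  = w
... | false = x ∷ y ∷ w

_·_ : Word → Word → Word
u · v = foldr _•_ v u

infixl 7 _·_

inv : Word → Word
inv w = reverse (map letterInv w)

e : Word
e = []

_^_ : Word → ℕ → Word
w ^ zero = e
w ^ suc k = w · (w ^ k)

genPow : Gen → ℤ → Word
genPow g (+ n) = replicate n (g , true)
genPow g -[1+ n ] = replicate (suc n) (g , false)

σ^ : ℤ → Word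
σ^ = genPow σ

τ^ : ℤ → Word
τ^ = genPow τ

I : Word → Word → Set
I α w = Reduced w × ∃ λ v → w ≡ α ++ v

private
  z : ℕ → ℤ
  z = +_

-- A_i^*, B_i^*, γ_i  (for the given n; meaningful for i < n).
A* : ℕ → ℕ → Word → Set
A* n zero = I (σ^ (+ 1))
A* n (suc zero) = I (τ^ (+ 1))
A* n i@(suc (suc _)) = I (σ^ (- z i + + 1) · τ^ (+ 1))

B* : ℕ → ℕ → Word → Set
B* n zero = I (σ^ (- z n + + 1))
B* n (suc zero) = I (σ^ (- z n + + 2) · τ^ (- + 1))
B* n i@(suc (suc _)) = I (σ^ (- z i + + 2) · τ^ (- + 1))

γ : ℕ → ℕ → Word
γ n zero = σ^ (z n + - + 1)
γ n (suc zero) = τ^ (+ 1) · σ^ (z n + - + 2)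
γ n i@(suc (suc _)) = σ^ (- z i + + 1) · τ^ (+ 1) · σ^ (z i + - + 2)

-- Every γ_i is a syllable σ^(-a) x σ^b in which x⁻¹ does not occur (x is τ^(±1), or σ for i = 0).
-- Hence if w is reduced and begins with α = σ^(-a) x, free cancellation in γ_i w stops before the
-- x of w, so γ_i w again begins with α.  Iterating from w = σ^(-m) gives the claim for
-- γ_i^k σ^(-m); the first step only needs σ^b σ^(-m) not to begin with x⁻¹, which is where
-- m < n - 1 enters for i = 0.  Since γ_i⁻¹ = σ^(-b) x⁻¹ σ^a is a syllable of the same kind, the
-- same argument gives the statement about B_i^*.
module Submission where

open import Defs
open import Data.Nat using (ℕ; _≤_; _<_; _∸_)
open import Data.Integer using (+_; -_)
open import Data.Product using (_×_)

import Data.Integer as ℤ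
open import Data.Bool using (true; false; not)
open import Data.Empty using (⊥-elim)
open import Data.List using ([]; _∷_; _++_; map; replicate; reverse)
open import Data.List.Properties using (foldr-++; map-++; reverse-++; unfold-reverse; ++-assoc; ++-identityʳ)
open import Data.List.Relation.Unary.All as All using (All)
open import Data.List.Relation.Unary.All.Properties using (replicate⁺)
open import Data.Nat using (zero; suc; _+_; s≤s)
open import Data.Nat.Properties using (m∸n+n≡m; m+[n∸m]≡n; ≤-total)
open import Data.Product using (_,_; ∃)
open import Data.Sum using (_⊎_; inj₁; inj₂)
open import Relation.Binary.PropositionalEquality

σ⁺ σ⁻ : Letter
σ⁺ = σ , true
σ⁻ = σ , false

letterInv-involutive : ∀ x → letterInv (letterInv x) ≡ x
letterInv-involutive (g , true)  = refl
letterInv-involutive (g , false) = refl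

≢letterInv : ∀ x → x ≢ letterInv x
≢letterInv (g , true)  ()
≢letterInv (g , false) ()

≢letterInv-sym : ∀ {x y} → y ≢ letterInv x → x ≢ letterInv y
≢letterInv-sym {y = y} y≢x⁻¹ x≡y⁻¹ = y≢x⁻¹ (trans (sym (letterInv-involutive y)) (cong letterInv (sym x≡y⁻¹)))

cancels-letterInv : ∀ x → cancels x (letterInv x) ≡ true
cancels-letterInv (σ , true)  = refl
cancels-letterInv (σ , false) = refl
cancels-letterInv (τ , true)  = refl
cancels-letterInv (τ , false) = refl

cancels⇒≡letterInv : ∀ x y → cancels x y ≡ true → y ≡ letterInv x
cancels⇒≡letterInv (σ , true)  (σ , false) _ = refl
cancels⇒≡letterInv (σ , false) (σ , true)  _ = refl
cancels⇒≡letterInv (τ , true)  (τ , false) _ = refl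
cancels⇒≡letterInv (τ , false) (τ , true)  _ = refl
cancels⇒≡letterInv (σ , true)  (σ , true)  ()
cancels⇒≡letterInv (σ , false) (σ , false) ()
cancels⇒≡letterInv (τ , true)  (τ , true)  ()
cancels⇒≡letterInv (τ , false) (τ , false) ()
cancels⇒≡letterInv (σ , true)  (τ , _)     ()
cancels⇒≡letterInv (σ , false) (τ , _)     ()
cancels⇒≡letterInv (τ , true)  (σ , _)     ()
cancels⇒≡letterInv (τ , false) (σ , _)     ()

¬cancels : ∀ {x y} → y ≢ letterInv x → cancels x y ≡ false
¬cancels {x} {y} y≢x⁻¹ with cancels x y in eq
... | true  = ⊥-elim (y≢x⁻¹ (cancels⇒≡letterInv x y eq))
... | false = refl

¬cancels⇒≢ : ∀ {x y} → cancels x y ≡ false → y ≢ letterInv x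
¬cancels⇒≢ {x} h refl with () ← trans (sym h) (cancels-letterInv x)

reduced-∷ : ∀ {x y w} → y ≢ letterInv x → Reduced (y ∷ w) → Reduced (x ∷ y ∷ w)
reduced-∷ y≢x⁻¹ = cons _ _ _ (¬cancels y≢x⁻¹)

reduced-tail : ∀ {x w} → Reduced (x ∷ w) → Reduced w
reduced-tail (one _)          = nil
reduced-tail (cons _ _ _ _ r) = r

reduced-graft : ∀ u {x v w} → Reduced (u ++ x ∷ v) → Reduced (x ∷ w) → Reduced (u ++ x ∷ w)
reduced-graft []          _                  r = r
reduced-graft (_ ∷ [])    (cons _ _ _ h _)   r = cons _ _ _ h r
reduced-graft (_ ∷ y ∷ u) (cons _ _ _ h r′)  r = cons _ _ _ h (reduced-graft (y ∷ u) r′ r)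

•-cancels : ∀ {x y} w → cancels x y ≡ true → x • (y ∷ w) ≡ w
•-cancels _ h rewrite h = refl

•-∷ : ∀ {x y} w → cancels x y ≡ false → x • (y ∷ w) ≡ x ∷ y ∷ w
•-∷ _ h rewrite h = refl

•-letterInv : ∀ x w → x • (letterInv x ∷ w) ≡ w
•-letterInv x w = •-cancels w (cancels-letterInv x)

•-≡-∷ : ∀ {x w} → Reduced (x ∷ w) → x • w ≡ x ∷ w
•-≡-∷ (one _)          = refl
•-≡-∷ (cons _ _ w h _) = •-∷ w h

reduced-• : ∀ x {w} → Reduced w → Reduced (x • w)
reduced-• x nil = one x
reduced-• x {y ∷ w} r with cancels x y in eq
... | true  = reduced-tail r
... | false = cons x y w eq r

reduced-· : ∀ u {v} → Reduced v → Reduced (u · v)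
reduced-· []      r = r
reduced-· (x ∷ u) r = reduced-• x (reduced-· u r)

·-++ : ∀ u v w → (u ++ v) · w ≡ u · (v · w)
·-++ u v w = foldr-++ _•_ w u v

·-≡-++ : ∀ u {v} → Reduced (u ++ v) → u · v ≡ u ++ v
·-≡-++ []      _ = refl
·-≡-++ (x ∷ u) r = trans (cong (x •_) (·-≡-++ u (reduced-tail r))) (•-≡-∷ r)

·-identityʳ : ∀ {u} → Reduced u → u · [] ≡ u
·-identityʳ {[]}    _ = refl
·-identityʳ {x ∷ u} r = trans (cong (x •_) (·-identityʳ (reduced-tail r))) (•-≡-∷ r)

•-letterInv-• : ∀ x {w} → Reduced w → x • (letterInv x • w) ≡ w
•-letterInv-• x nil = •-letterInv x []
•-letterInv-• x {y ∷ w} r with cancels (letterInv x) y in eq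
... | true with refl ← trans (cancels⇒≡letterInv _ y eq) (letterInv-involutive x) = •-≡-∷ r
... | false = •-letterInv x (y ∷ w)

•-· : ∀ x {u w} → Reduced u → Reduced w → (x • u) · w ≡ x • (u · w)
•-· x nil _ = refl
•-· x {y ∷ u} _ rw with cancels x y in eq
... | true with refl ← cancels⇒≡letterInv x y eq = sym (•-letterInv-• x (reduced-· u rw))
... | false = refl

·-assoc : ∀ u {v w} → Reduced v → Reduced w → (u · v) · w ≡ u · (v · w)
·-assoc []      _  _  = refl
·-assoc (x ∷ u) rv rw = trans (•-· x (reduced-· u rv) rw) (cong (x •_) (·-assoc u rv rw))

reduced-^ : ∀ {u} → Reduced u → ∀ k → Reduced (u ^ k)
reduced-^ _ zero        = nil
reduced-^ {u} r (suc k) = reduced-· u (reduced-^ r k)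

^-·-comm : ∀ {u} → Reduced u → ∀ k → (u ^ k) · u ≡ u · (u ^ k)
^-·-comm r zero        = sym (·-identityʳ r)
^-·-comm {u} r (suc k) = trans (·-assoc u (reduced-^ r k) r) (cong (u ·_) (^-·-comm r k))

inv-∷ : ∀ x w → inv (x ∷ w) ≡ inv w ++ letterInv x ∷ []
inv-∷ x w = unfold-reverse (letterInv x) (map letterInv w)

inv-++ : ∀ u v → inv (u ++ v) ≡ inv v ++ inv u
inv-++ u v = trans (cong reverse (map-++ letterInv u v)) (reverse-++ (map letterInv u) _)

reduced-inv : ∀ {w} → Reduced w → Reduced (inv w)
reduced-inv nil              = nil
reduced-inv (one _)          = one _
reduced-inv (cons x y w h r) =
  subst Reduced (sym inv-x∷y∷w)
    (reduced-graft (inv w) (subst Reduced (inv-∷ y w) (reduced-inv r)) (reduced-∷ x⁻¹≢y (one _)))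
  where
  inv-x∷y∷w : inv (x ∷ y ∷ w) ≡ inv w ++ letterInv y ∷ letterInv x ∷ []
  inv-x∷y∷w = trans (inv-∷ x (y ∷ w)) (trans (cong (_++ _) (inv-∷ y w)) (++-assoc (inv w) _ _))
  x⁻¹≢y : letterInv x ≢ letterInv (letterInv y)
  x⁻¹≢y e = ¬cancels⇒≢ h (trans (sym (letterInv-involutive y)) (sym e))

inv-• : ∀ x {w} → Reduced w → inv (x • w) ≡ inv w · (letterInv x ∷ [])
inv-• x nil = refl
inv-• x {y ∷ w} r with cancels x y in eq
... | true with refl ← cancels⇒≡letterInv x y eq = begin
    inv w                                                   ≡⟨ ·-identityʳ (reduced-inv (reduced-tail r)) ⟨
    inv w · []                                              ≡⟨ cong (inv w ·_) (•-letterInv x []) ⟨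
    inv w · (x • (letterInv x ∷ []))                        ≡⟨ ·-++ (inv w) (x ∷ []) _ ⟨
    (inv w ++ x ∷ []) · (letterInv x ∷ [])                  ≡⟨ cong (λ z → (inv w ++ z ∷ []) · (letterInv x ∷ [])) (letterInv-involutive x) ⟨
    (inv w ++ letterInv (letterInv x) ∷ []) · (letterInv x ∷ []) ≡⟨ cong (_· _) (inv-∷ (letterInv x) w) ⟨
    inv (letterInv x ∷ w) · (letterInv x ∷ [])              ∎
  where open ≡-Reasoning
... | false = trans (inv-∷ x (y ∷ w))
                (sym (·-≡-++ (inv (y ∷ w)) (subst Reduced (inv-∷ x (y ∷ w)) (reduced-inv (cons x y w eq r)))))

inv-· : ∀ u {v} → Reduced u → Reduced v → inv (u · v) ≡ inv v · inv u
inv-· []      _  rv = sym (·-identityʳ (reduced-inv rv))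
inv-· (x ∷ u) {v} ru rv = begin
    inv (x • (u · v))                     ≡⟨ inv-• x (reduced-· u rv) ⟩
    inv (u · v) · (letterInv x ∷ [])      ≡⟨ cong (_· _) (inv-· u (reduced-tail ru) rv) ⟩
    (inv v · inv u) · (letterInv x ∷ [])  ≡⟨ ·-assoc (inv v) (reduced-inv (reduced-tail ru)) (one _) ⟩
    inv v · (inv u · (letterInv x ∷ []))  ≡⟨ cong (inv v ·_) (·-≡-++ (inv u) (subst Reduced (inv-∷ x u) (reduced-inv ru))) ⟩
    inv v · (inv u ++ letterInv x ∷ [])   ≡⟨ cong (inv v ·_) (inv-∷ x u) ⟨
    inv v · inv (x ∷ u)                   ∎
  where open ≡-Reasoning

inv-^ : ∀ {u} → Reduced u → ∀ k → inv (u ^ k) ≡ inv u ^ k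
inv-^ _ zero = refl
inv-^ {u} r (suc k) = begin
    inv (u · (u ^ k))      ≡⟨ cong inv (^-·-comm r k) ⟨
    inv ((u ^ k) · u)      ≡⟨ inv-· (u ^ k) (reduced-^ r k) r ⟩
    inv u · inv (u ^ k)    ≡⟨ cong (inv u ·_) (inv-^ r k) ⟩
    inv u · (inv u ^ k)    ∎
  where open ≡-Reasoning

·-++-∷ : ∀ {x} u {r} v → All (_≢ letterInv x) u → All (_≢ letterInv x) r →
  ∃ λ r′ → All (_≢ letterInv x) r′ × u · ((r ++ x ∷ []) ++ v) ≡ r′ ++ x ∷ v
·-++-∷ [] {r} v _ r-avoids = r , r-avoids , ++-assoc r _ v
·-++-∷ {x} (y ∷ u) v (y≢x⁻¹ All.∷ u-avoids) r-avoids with ·-++-∷ u v u-avoids r-avoids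
... | [] , _ , eq =
  y ∷ [] , y≢x⁻¹ All.∷ All.[] , trans (cong (y •_) eq) (•-∷ v (¬cancels (≢letterInv-sym y≢x⁻¹)))
... | z ∷ r′ , z≢x⁻¹ All.∷ r′-avoids , eq with cancels y z in yz
...   | true  = r′ , r′-avoids , trans (cong (y •_) eq) (•-cancels _ yz)
...   | false = y ∷ z ∷ r′ , y≢x⁻¹ All.∷ z≢x⁻¹ All.∷ r′-avoids , trans (cong (y •_) eq) (•-∷ _ yz)

reduced-∷-· : ∀ {x} u r {v} → All (_≢ letterInv x) u → All (_≢ letterInv x) r →
  Reduced (u · ((r ++ x ∷ []) ++ v)) → Reduced (x ∷ u · ((r ++ x ∷ []) ++ v))
reduced-∷-· {x} u r {v} u-avoids r-avoids with u · ((r ++ x ∷ []) ++ v) | ·-++-∷ u v u-avoids r-avoids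
... | _ | [] , _ , refl = reduced-∷ (≢letterInv x)
... | _ | y ∷ _ , y≢x⁻¹ All.∷ _ , refl = reduced-∷ y≢x⁻¹

·-prefix : ∀ α₀ {x β z} → Reduced (α₀ ++ x ∷ β) → Reduced (x ∷ β · z) → (α₀ ++ x ∷ β) · z ≡ α₀ ++ x ∷ β · z
·-prefix α₀ {x} {β} {z} rδ rxz = begin
    (α₀ ++ x ∷ β) · z    ≡⟨ ·-++ α₀ (x ∷ β) z ⟩
    α₀ · (x • (β · z))   ≡⟨ cong (α₀ ·_) (•-≡-∷ rxz) ⟩
    α₀ · (x ∷ β · z)     ≡⟨ ·-≡-++ α₀ (reduced-graft α₀ rδ rxz) ⟩
    α₀ ++ x ∷ β · z      ∎
  where open ≡-Reasoning

I-· : ∀ {α₀ x β z} → Reduced (α₀ ++ x ∷ β) → Reduced z → Reduced (x ∷ β · z) →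
  I (α₀ ++ x ∷ []) ((α₀ ++ x ∷ β) · z)
I-· {α₀} {x} {β} rδ rz rxz =
  reduced-· (α₀ ++ x ∷ β) rz , β · _ , trans (·-prefix α₀ rδ rxz) (sym (++-assoc α₀ (x ∷ []) _))

I-·-closed : ∀ {α₀ x β z} → Reduced (α₀ ++ x ∷ β) → All (_≢ letterInv x) α₀ → All (_≢ letterInv x) β →
  I (α₀ ++ x ∷ []) z → I (α₀ ++ x ∷ []) ((α₀ ++ x ∷ β) · z)
I-·-closed {α₀} {β = β} rδ α₀-avoids β-avoids (rz , _ , refl) =
  I-· rδ rz (reduced-∷-· β α₀ β-avoids α₀-avoids (reduced-· β rz))

I-^-· : ∀ {α₀ x β w} → Reduced (α₀ ++ x ∷ β) → All (_≢ letterInv x) α₀ → All (_≢ letterInv x) β →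
  Reduced w → Reduced (x ∷ β · w) → ∀ k → I (α₀ ++ x ∷ []) ((α₀ ++ x ∷ β) ^ suc k · w)
I-^-· rδ _ _ rw rxw zero rewrite ·-identityʳ rδ = I-· rδ rw rxw
I-^-· {α₀} {x} {β} rδ α₀-avoids β-avoids rw rxw (suc k)
  rewrite ·-assoc (α₀ ++ x ∷ β) (reduced-^ rδ (suc k)) rw =
  I-·-closed rδ α₀-avoids β-avoids (I-^-· rδ α₀-avoids β-avoids rw rxw k)

replicate-+ : ∀ a b (x : Letter) → replicate (a + b) x ≡ replicate a x ++ replicate b x
replicate-+ zero    b x = refl
replicate-+ (suc a) b x = cong (x ∷_) (replicate-+ a b x)

∷-replicate-++ : ∀ a (x : Letter) v → x ∷ replicate a x ++ v ≡ replicate a x ++ x ∷ v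
∷-replicate-++ zero    x v = refl
∷-replicate-++ (suc a) x v = cong (x ∷_) (∷-replicate-++ a x v)

inv-replicate : ∀ a x → inv (replicate a x) ≡ replicate a (letterInv x)
inv-replicate zero    x = refl
inv-replicate (suc a) x = begin
    inv (x ∷ replicate a x)                          ≡⟨ inv-∷ x (replicate a x) ⟩
    inv (replicate a x) ++ letterInv x ∷ []          ≡⟨ cong (_++ _) (inv-replicate a x) ⟩
    replicate a (letterInv x) ++ letterInv x ∷ []    ≡⟨ ∷-replicate-++ a (letterInv x) [] ⟨
    letterInv x ∷ replicate a (letterInv x) ++ []    ≡⟨ cong (letterInv x ∷_) (++-identityʳ _) ⟩
    replicate (suc a) (letterInv x)                  ∎
  where open ≡-Reasoning

replicate-·-cancel : ∀ b x v → replicate b x · (replicate b (letterInv x) ++ v) ≡ v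
replicate-·-cancel zero    x v = refl
replicate-·-cancel (suc b) x v = begin
    x • (replicate b x · (letterInv x ∷ replicate b (letterInv x) ++ v))
      ≡⟨ cong (λ w → x • (replicate b x · w)) (∷-replicate-++ b (letterInv x) v) ⟩
    x • (replicate b x · (replicate b (letterInv x) ++ letterInv x ∷ v))
      ≡⟨ cong (x •_) (replicate-·-cancel b x (letterInv x ∷ v)) ⟩
    x • (letterInv x ∷ v)
      ≡⟨ •-letterInv x v ⟩
    v ∎
  where open ≡-Reasoning

reduced-∷-replicate : ∀ {x y} b → y ≢ letterInv x → Reduced (x ∷ replicate b y)
reduced-∷-replicate         zero    _     = one _
reduced-∷-replicate {y = y} (suc b) y≢x⁻¹ = reduced-∷ y≢x⁻¹ (reduced-∷-replicate b (≢letterInv y))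

reduced-replicate : ∀ b x → Reduced (replicate b x)
reduced-replicate zero    _ = nil
reduced-replicate (suc b) x = reduced-∷-replicate b (≢letterInv x)

reduced-replicate-++ : ∀ a {p x w} → x ≢ letterInv p → Reduced (x ∷ w) → Reduced (replicate a p ++ x ∷ w)
reduced-replicate-++ zero              _     r = r
reduced-replicate-++ (suc zero)        x≢p⁻¹ r = reduced-∷ x≢p⁻¹ r
reduced-replicate-++ (suc (suc a)) {p} x≢p⁻¹ r = reduced-∷ (≢letterInv p) (reduced-replicate-++ (suc a) x≢p⁻¹ r)

replicate-·-replicate-≥ : ∀ {a b} x → b ≤ a → replicate a x · replicate b (letterInv x) ≡ replicate (a ∸ b) x
replicate-·-replicate-≥ {a} {b} x b≤a = begin
    replicate a x · replicate b (letterInv x)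
      ≡⟨ cong (λ c → replicate c x · replicate b (letterInv x)) (m∸n+n≡m b≤a) ⟨
    replicate (a ∸ b + b) x · replicate b (letterInv x)
      ≡⟨ cong (_· replicate b (letterInv x)) (replicate-+ (a ∸ b) b x) ⟩
    (replicate (a ∸ b) x ++ replicate b x) · replicate b (letterInv x)
      ≡⟨ ·-++ (replicate (a ∸ b) x) (replicate b x) _ ⟩
    replicate (a ∸ b) x · (replicate b x · replicate b (letterInv x))
      ≡⟨ cong (λ w → replicate (a ∸ b) x · (replicate b x · w)) (++-identityʳ _) ⟨
    replicate (a ∸ b) x · (replicate b x · (replicate b (letterInv x) ++ []))
      ≡⟨ cong (replicate (a ∸ b) x ·_) (replicate-·-cancel b x []) ⟩
    replicate (a ∸ b) x · []
      ≡⟨ ·-identityʳ (reduced-replicate (a ∸ b) x) ⟩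
    replicate (a ∸ b) x ∎
  where open ≡-Reasoning

replicate-·-replicate-≤ : ∀ {a b} x → a ≤ b → replicate a x · replicate b (letterInv x) ≡ replicate (b ∸ a) (letterInv x)
replicate-·-replicate-≤ {a} {b} x a≤b = begin
    replicate a x · replicate b (letterInv x)
      ≡⟨ cong (λ c → replicate a x · replicate c (letterInv x)) (m+[n∸m]≡n a≤b) ⟨
    replicate a x · replicate (a + (b ∸ a)) (letterInv x)
      ≡⟨ cong (replicate a x ·_) (replicate-+ a (b ∸ a) (letterInv x)) ⟩
    replicate a x · (replicate a (letterInv x) ++ replicate (b ∸ a) (letterInv x))
      ≡⟨ replicate-·-cancel a x _ ⟩
    replicate (b ∸ a) (letterInv x) ∎
  where open ≡-Reasoning

replicate-·-replicate : ∀ a b x →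
  (∃ λ c → replicate a x · replicate b (letterInv x) ≡ replicate c x) ⊎
  (∃ λ c → replicate a x · replicate b (letterInv x) ≡ replicate c (letterInv x))
replicate-·-replicate a b x with ≤-total b a
... | inj₁ b≤a = inj₁ (a ∸ b , replicate-·-replicate-≥ x b≤a)
... | inj₂ a≤b = inj₂ (b ∸ a , replicate-·-replicate-≤ x a≤b)

syllable : ℕ → Letter → ℕ → Word
syllable a x b = replicate a σ⁻ ++ x ∷ replicate b σ⁺

inv-syllable : ∀ a x b → inv (syllable a x b) ≡ syllable b (letterInv x) a
inv-syllable a x b = begin
    inv (replicate a σ⁻ ++ x ∷ replicate b σ⁺)
      ≡⟨ inv-++ (replicate a σ⁻) (x ∷ replicate b σ⁺) ⟩
    inv (x ∷ replicate b σ⁺) ++ inv (replicate a σ⁻)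
      ≡⟨ cong₂ _++_ (inv-∷ x (replicate b σ⁺)) (inv-replicate a σ⁻) ⟩
    (inv (replicate b σ⁺) ++ letterInv x ∷ []) ++ replicate a σ⁺
      ≡⟨ cong (λ w → (w ++ letterInv x ∷ []) ++ replicate a σ⁺) (inv-replicate b σ⁺) ⟩
    (replicate b σ⁻ ++ letterInv x ∷ []) ++ replicate a σ⁺
      ≡⟨ ++-assoc (replicate b σ⁻) (letterInv x ∷ []) (replicate a σ⁺) ⟩
    replicate b σ⁻ ++ letterInv x ∷ replicate a σ⁺ ∎
  where open ≡-Reasoning

inv-syllable-^ : ∀ {a x b} → Reduced (syllable a x b) → ∀ k → inv (syllable a x b ^ k) ≡ syllable b (letterInv x) a ^ k
inv-syllable-^ {a} {x} {b} r k = trans (inv-^ r k) (cong (_^ k) (inv-syllable a x b))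

reduced-τ-syllable : ∀ a c b → Reduced (syllable a (τ , c) b)
reduced-τ-syllable a c b = reduced-replicate-++ a (λ ()) (reduced-∷-replicate b (λ ()))

τ-syllable-^-prefix : ∀ a c b m k →
  I (replicate a σ⁻ ++ (τ , c) ∷ []) (syllable a (τ , c) b ^ suc k · replicate m σ⁻)
τ-syllable-^-prefix a c b m =
  I-^-· (reduced-τ-syllable a c b) (replicate⁺ a (λ ())) (replicate⁺ b (λ ())) (reduced-replicate m σ⁻) start
  where
  start : Reduced ((τ , c) ∷ replicate b σ⁺ · replicate m σ⁻)
  start with replicate-·-replicate b m σ⁺
  ... | inj₁ (d , eq) rewrite eq = reduced-∷-replicate d (λ ())
  ... | inj₂ (d , eq) rewrite eq = reduced-∷-replicate d (λ ())

τ-syllable-prefixes : ∀ a c b m k →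
  I (replicate a σ⁻ ++ (τ , c) ∷ []) (syllable a (τ , c) b ^ suc k · replicate m σ⁻) ×
  I (replicate b σ⁻ ++ (τ , not c) ∷ []) (inv (syllable a (τ , c) b ^ suc k) · replicate m σ⁻)
τ-syllable-prefixes a c b m k =
  τ-syllable-^-prefix a c b m k ,
  subst (λ w → I _ (w · replicate m σ⁻)) (sym (inv-syllable-^ (reduced-τ-syllable a c b) (suc k)))
    (τ-syllable-^-prefix b (not c) a m k)

σ-power-prefixes : ∀ {j m} → m ≤ j → ∀ k →
  I (σ⁺ ∷ []) (syllable 0 σ⁺ j ^ suc k · replicate m σ⁻) ×
  I (replicate (suc j) σ⁻) (inv (syllable 0 σ⁺ j ^ suc k) · replicate m σ⁻)
σ-power-prefixes {j} {m} m≤j k =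
  I-^-· (reduced-replicate (suc j) σ⁺) All.[] (replicate⁺ j (λ ())) (reduced-replicate m σ⁻) start k ,
  subst₂ (λ α w → I α (w · replicate m σ⁻))
    (trans (sym (∷-replicate-++ j σ⁻ [])) (cong (σ⁻ ∷_) (++-identityʳ _)))
    (sym (inv-syllable-^ {0} {σ⁺} {j} (reduced-replicate (suc j) σ⁺) (suc k)))
    (I-^-· (reduced-replicate-++ j (λ ()) (one σ⁻)) (replicate⁺ j (λ ())) All.[]
       (reduced-replicate m σ⁻) (reduced-replicate (suc m) σ⁻) k)
  where
  start : Reduced (σ⁺ ∷ replicate j σ⁺ · replicate m σ⁻)
  start rewrite replicate-·-replicate-≥ σ⁺ m≤j = reduced-replicate (suc (j ∸ m)) σ⁺

σ^-neg : ∀ m → σ^ (- (+ m)) ≡ replicate m σ⁻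
σ^-neg zero    = refl
σ^-neg (suc m) = refl

σ^-[2+j]+2 : ∀ j → σ^ (- (+ suc (suc j)) ℤ.+ + 2) ≡ replicate j σ⁻
σ^-[2+j]+2 zero    = refl
σ^-[2+j]+2 (suc j) = refl

σ⁻-run-·-τ : ∀ a c → replicate a σ⁻ · ((τ , c) ∷ []) ≡ replicate a σ⁻ ++ (τ , c) ∷ []
σ⁻-run-·-τ a c = ·-≡-++ (replicate a σ⁻) (reduced-replicate-++ a (λ ()) (one _))

γ₁-syllable : ∀ j → γ (suc (suc j)) 1 ≡ syllable 0 (τ , true) j
γ₁-syllable j = •-≡-∷ (reduced-τ-syllable 0 true j)

γ-syllable : ∀ n j → γ n (suc (suc j)) ≡ syllable (suc j) (τ , true) j
γ-syllable n j = trans (cong (_· replicate j σ⁺) (σ⁻-run-·-τ (suc j) true))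
                       (·-prefix (replicate (suc j) σ⁻) (reduced-τ-syllable (suc j) true 0) (reduced-∷-replicate j (λ ())))

lemma2p4 : (n : ℕ) → 2 ≤ n → (i : ℕ) → i < n → (k : ℕ) → 1 ≤ k → (m : ℕ) → m < n ∸ 1 →
    A* n i ((γ n i ^ k) · σ^ (- (+ m))) × B* n i (inv (γ n i ^ k) · σ^ (- (+ m)))
lemma2p4 (suc (suc j)) _ zero _ (suc k) _ m (s≤s m≤j) rewrite σ^-neg m = σ-power-prefixes m≤j k
lemma2p4 (suc (suc j)) _ (suc zero) _ (suc k) _ m _
  rewrite σ^-neg m | γ₁-syllable j | σ^-[2+j]+2 j | σ⁻-run-·-τ j false =
  τ-syllable-prefixes 0 true j m k
lemma2p4 n _ (suc (suc j)) _ (suc k) _ m _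
  rewrite σ^-neg m | γ-syllable n j | σ^-[2+j]+2 j | σ⁻-run-·-τ j false | σ⁻-run-·-τ (suc j) true =
  τ-syllable-prefixes (suc j) true j m k
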